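{- For any poset $P$ and any nonnegative integer $k$, the digraph $\delta_R^k(\mathcal{N}(P))$ retracts to (an induced subdigraph isomorphic to) $\mathcal{N}(\mathcal{I}^k(P))$.
   Context: The nondomination digraph $\mathcal{N}(P)$ of a poset $P$ has the elements of $P$ as vertices and as arcs the ordered pairs $(u,v)$ with $u \not\geq v$. $\mathcal{I}(P)$ is the poset of ideals (downsets, including the empty one) of $P$ ordered by inclusion, and $\mathcal{I}^k$ its $k$-fold iteration ($\mathcal{I}^0(P)=P$). For a digraph $K$, $\delta_R(K)$ is the digraph whose vertices are the ordered pairs $(X,Y)$ of (possibly empty) vertex sets of $K$ such that $(x,y)$ is an arc of $K$ for all $x \in X$, $y \in Y$, and whose arcs are the pairs $((X,Y),(Z,W))$ with $Y \cap Z \neq \emptyset$; $\delta_R^k$ is its $k$-fold iteration ($\delta_R^0$ the identity). A subdigraph $H$ of $G$ is a retract of $G$ if there is a homomorphism (arc-preserving vertex map) $\rho: G \to H$ restricting to the identity on $H$. -}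

module Defs where

open import Level using (Level; _⊔_) renaming (suc to lsuc)
open import Data.Nat using (ℕ; zero; suc)
open import Data.Product using (Σ; ∃; _×_; _,_; proj₁; proj₂)
open import Relation.Binary using (Rel; IsEquivalence; IsPreorder; IsPartialOrder; Poset; _Respects₂_)
open import Relation.Nullary using (¬_)

record Digraph (c e a : Level) : Set (lsuc (c ⊔ e ⊔ a)) where
  field
    Vertex        : Set c
    _≈_           : Rel Vertex e
    isEquivalence : IsEquivalence _≈_
    Arc           : Rel Vertex a
    Arc-resp      : Arc Respects₂ _≈_

record Hom {c e a c′ e′ a′ : Level} (G : Digraph c e a) (H : Digraph c′ e′ a′)
       : Set (c ⊔ e ⊔ a ⊔ c′ ⊔ e′ ⊔ a′) where
  private
    module G = Digraph G
    module H = Digraph H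
  field
    fun  : G.Vertex → H.Vertex
    cong : ∀ {x y} → x G.≈ y → fun x H.≈ fun y
    arc  : ∀ {x y} → G.Arc x y → H.Arc (fun x) (fun y)

-- G retracts to an (induced) subdigraph isomorphic to H:
-- there are homomorphisms e : H → G and r : G → H with r ∘ e = id_H.
-- (Then e(H) is an induced subdigraph of G isomorphic to H via e, and
--  e ∘ r : G → e(H) is a retraction.)
RetractsTo : {c e a c′ e′ a′ : Level} → Digraph c e a → Digraph c′ e′ a′
           → Set (c ⊔ e ⊔ a ⊔ c′ ⊔ e′ ⊔ a′)
RetractsTo G H =
  Σ (Hom H G) λ emb → Σ (Hom G H) λ ret →
    ∀ v → Hom.fun ret (Hom.fun emb v) ≈ v
  where open Digraph H

N : {c ℓ₁ ℓ₂ : Level} → Poset c ℓ₁ ℓ₂ → Digraph c ℓ₁ ℓ₂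
N P = record
  { Vertex        = Carrier
  ; _≈_           = _≈_
  ; isEquivalence = isEquivalence
  ; Arc           = λ u v → ¬ (v ≤ u)
  ; Arc-resp      = (λ y≈y′ ¬y≤x y′≤x → ¬y≤x (≤-respˡ-≈ (Eq.sym y≈y′) y′≤x))
                  , (λ x≈x′ ¬y≤x y≤x′ → ¬y≤x (≤-respʳ-≈ (Eq.sym x≈x′) y≤x′))
  }
  where open Poset P

record Subset {c e a : Level} (K : Digraph c e a) (ℓ : Level) : Set (c ⊔ e ⊔ lsuc ℓ) where
  open Digraph K
  field
    mem  : Vertex → Set ℓ
    resp : ∀ {x y} → x ≈ y → mem x → mem y

open Subset public

_⊆ˢ_ : {c e a ℓ : Level} {K : Digraph c e a} → Subset K ℓ → Subset K ℓ → Set (c ⊔ ℓ)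
A ⊆ˢ B = ∀ x → mem A x → mem B x

_≐ˢ_ : {c e a ℓ : Level} {K : Digraph c e a} → Subset K ℓ → Subset K ℓ → Set (c ⊔ ℓ)
A ≐ˢ B = (A ⊆ˢ B) × (B ⊆ˢ A)

record DVertex {c e a : Level} (K : Digraph c e a) : Set (c ⊔ e ⊔ lsuc a) where
  open Digraph K
  field
    X      : Subset K a
    Y      : Subset K a
    compat : ∀ {x y} → mem X x → mem Y y → Arc x y

open DVertex public

δR : {c e a : Level} → Digraph c e a → Digraph (c ⊔ e ⊔ lsuc a) (c ⊔ a) (c ⊔ a)
δR {c} {e} {a} K = record
  { Vertex        = DVertex K
  ; _≈_           = _≋_
  ; isEquivalence = record
      { refl  = ((λ _ p → p) , (λ _ p → p)) , ((λ _ p → p) , (λ _ p → p))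
      ; sym   = λ { ((f , g) , (h , k)) → (g , f) , (k , h) }
      ; trans = λ { ((f , g) , (h , k)) ((f′ , g′) , (h′ , k′)) →
                    ((λ x p → f′ x (f x p)) , (λ x p → g x (g′ x p)))
                  , ((λ x p → h′ x (h x p)) , (λ x p → k x (k′ x p))) }
      }
  ; Arc           = DArc
  ; Arc-resp      = (λ { ((f , _) , _) (z , yz , zz) → z , yz , f z zz })
                  , (λ { (_ , (h , _)) (z , yz , zz) → z , h z yz , zz })
  }
  where
  _≋_ : DVertex K → DVertex K → Set (c ⊔ a)
  u ≋ v = (X u ≐ˢ X v) × (Y u ≐ˢ Y v)
  DArc : DVertex K → DVertex K → Set (c ⊔ a)
  DArc u v = ∃ λ z → mem (Y u) z × mem (X v) z

dc de da : ℕ → Level → Level → Level → Level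
dc zero    c e a = c
dc (suc k) c e a = dc k c e a ⊔ de k c e a ⊔ lsuc (da k c e a)
de zero    c e a = e
de (suc k) c e a = dc k c e a ⊔ da k c e a
da zero    c e a = a
da (suc k) c e a = dc k c e a ⊔ da k c e a

δR^ : {c e a : Level} (k : ℕ) → Digraph c e a → Digraph (dc k c e a) (de k c e a) (da k c e a)
δR^ zero    K = K
δR^ (suc k) K = δR (δR^ k K)

-- Ideals (downsets, including the empty one) of a poset, ordered by inclusion.

record Ideal {c ℓ₁ ℓ₂ : Level} (P : Poset c ℓ₁ ℓ₂) : Set (c ⊔ lsuc ℓ₂) where
  open Poset P
  field
    elem : Carrier → Set ℓ₂
    down : ∀ {x y} → x ≤ y → elem y → elem x

open Ideal public

I : {c ℓ₁ ℓ₂ : Level} → Poset c ℓ₁ ℓ₂ → Poset (c ⊔ lsuc ℓ₂) (c ⊔ ℓ₂) (c ⊔ ℓ₂)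
I {c} {ℓ₁} {ℓ₂} P = record
  { Carrier        = Ideal P
  ; _≈_            = λ A B → (A ⊑ B) × (B ⊑ A)
  ; _≤_            = _⊑_
  ; isPartialOrder = record
      { isPreorder = record
          { isEquivalence = record
              { refl  = (λ _ p → p) , (λ _ p → p)
              ; sym   = λ { (f , g) → g , f }
              ; trans = λ { (f , g) (f′ , g′) → (λ x p → f′ x (f x p)) , (λ x p → g x (g′ x p)) }
              }
          ; reflexive = proj₁
          ; trans     = λ f g x p → g x (f x p)
          }
      ; antisym = λ f g → f , g
      }
  }
  where
  _⊑_ : Ideal P → Ideal P → Set (c ⊔ ℓ₂)
  A ⊑ B = ∀ x → elem A x → elem B x

ic iℓ : ℕ → Level → Level → Level → Level
ic zero    c ℓ₁ ℓ₂ = c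
ic (suc k) c ℓ₁ ℓ₂ = ic k c ℓ₁ ℓ₂ ⊔ lsuc (iℓ k c ℓ₁ ℓ₂)
iℓ zero    c ℓ₁ ℓ₂ = ℓ₂
iℓ (suc k) c ℓ₁ ℓ₂ = ic k c ℓ₁ ℓ₂ ⊔ iℓ k c ℓ₁ ℓ₂

iℓ₁ : ℕ → Level → Level → Level → Level
iℓ₁ zero    c ℓ₁ ℓ₂ = ℓ₁
iℓ₁ (suc k) c ℓ₁ ℓ₂ = ic k c ℓ₁ ℓ₂ ⊔ iℓ k c ℓ₁ ℓ₂

I^ : {c ℓ₁ ℓ₂ : Level} (k : ℕ) → Poset c ℓ₁ ℓ₂
   → Poset (ic k c ℓ₁ ℓ₂) (iℓ₁ k c ℓ₁ ℓ₂) (iℓ k c ℓ₁ ℓ₂)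
I^ zero    P = P
I^ (suc k) P = I (I^ k P)

-- The pairs (A , Q∖A), for ideals A of Q, form a copy of N(I Q) inside δR(N Q): an arc
-- A → B of N(I Q) means B ⊈ A, i.e. a point of (Q∖A) ∩ B, i.e. an arc (A , Q∖A) → (B , Q∖B).
-- The map (X , Y) ↦ ↓X retracts onto this copy: an arc (X , Y) → (Z , W) gives z ∈ Y ∩ Z,
-- and z ≤ x for some x ∈ X is excluded by the compatibility of X with Y, so ↓Z ⊈ ↓X.
-- Since δR acts on homomorphisms functorially it preserves retracts, and induction on k
-- chains δR^(k+1)(N P) → δR(N(I^k P)) → N(I^(k+1) P).
module Submission where

open import Level using (Level; Lift; lift; lower)
open import Data.Nat using (ℕ; zero; suc)
open import Data.Product using (∃; _×_; _,_; proj₁; proj₂)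
open import Relation.Binary using (Poset; IsEquivalence)
open import Relation.Nullary using (¬_)
open import Relation.Nullary.Decidable using (True; toWitness; fromWitness)
open import Axiom.ExcludedMiddle using (ExcludedMiddle)
open import Axiom.DoubleNegationElimination using (em⇒dne)
open import Defs

Hom-id : ∀ {c e a} (G : Digraph c e a) → Hom G G
Hom-id G = record { fun = λ x → x ; cong = λ x≈y → x≈y ; arc = λ xy → xy }

_∘ʰ_ : ∀ {c e a c′ e′ a′ c″ e″ a″}
         {G : Digraph c e a} {H : Digraph c′ e′ a′} {L : Digraph c″ e″ a″}
     → Hom H L → Hom G H → Hom G L
g ∘ʰ f = record
  { fun  = λ x → Hom.fun g (Hom.fun f x)
  ; cong = λ x≈y → Hom.cong g (Hom.cong f x≈y)
  ; arc  = λ xy → Hom.arc g (Hom.arc f xy)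
  }

RetractsTo-refl : ∀ {c e a} (G : Digraph c e a) → RetractsTo G G
RetractsTo-refl G = Hom-id G , Hom-id G , λ _ → IsEquivalence.refl (Digraph.isEquivalence G)

RetractsTo-trans : ∀ {c e a c′ e′ a′ c″ e″ a″}
                     {G : Digraph c e a} {H : Digraph c′ e′ a′} {L : Digraph c″ e″ a″}
                 → RetractsTo G H → RetractsTo H L → RetractsTo G L
RetractsTo-trans {L = L} (e₁ , r₁ , r₁∘e₁≈id) (e₂ , r₂ , r₂∘e₂≈id) =
  e₁ ∘ʰ e₂ , r₂ ∘ʰ r₁ , λ v →
    IsEquivalence.trans (Digraph.isEquivalence L)
      (Hom.cong r₂ (r₁∘e₁≈id (Hom.fun e₂ v))) (r₂∘e₂≈id v)

module Classical (lem : ∀ {ℓ} → ExcludedMiddle ℓ) where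

  -- A decided proposition is equivalent to ⊤ or ⊥, so it can be moved to any universe level.
  -- This is how images and down-closures become subsets at the levels that δR and I prescribe.
  Resize : ∀ {ℓ} (ℓ′ : Level) → Set ℓ → Set ℓ′
  Resize ℓ′ A = Lift ℓ′ (True (lem {P = A}))

  resize : ∀ {ℓ ℓ′} {A : Set ℓ} → A → Resize ℓ′ A
  resize a = lift (fromWitness a)

  unresize : ∀ {ℓ ℓ′} {A : Set ℓ} → Resize ℓ′ A → A
  unresize r = toWitness (lower r)

  ¬⊆⇒∃∖ : ∀ {a b c} {A : Set a} {B : A → Set b} {C : A → Set c}
        → ¬ (∀ x → B x → C x) → ∃ λ x → B x × ¬ C x
  ¬⊆⇒∃∖ B⊈C = em⇒dne lem λ ¬∃ → B⊈C λ x Bx → em⇒dne lem λ ¬Cx → ¬∃ (x , Bx , ¬Cx)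

  module _ {c e a c′ e′ a′} {K : Digraph c e a} {L : Digraph c′ e′ a′} (f : Hom K L) where
    private
      module L = Digraph L
      module ≈ = IsEquivalence L.isEquivalence
      open Hom f using (fun)

    image : Subset K a → Subset L a′
    image S = record
      { mem  = λ v → Resize a′ (∃ λ x → mem S x × fun x L.≈ v)
      ; resp = λ v≈w p → let (x , x∈S , fx≈v) = unresize p
                         in  resize (x , x∈S , ≈.trans fx≈v v≈w)
      }

    image-mono : {S T : Subset K a} → S ⊆ˢ T → image S ⊆ˢ image T
    image-mono S⊆T v p =
      let (x , x∈S , fx≈v) = unresize p in resize (x , S⊆T x x∈S , fx≈v)

    image-compat : (u : DVertex K) → ∀ {v w}
                 → mem (image (X u)) v → mem (image (Y u)) w → L.Arc v w
    image-compat u p q =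
      let (x , x∈X , fx≈v) = unresize p
          (y , y∈Y , fy≈w) = unresize q
      in  proj₁ L.Arc-resp fy≈w (proj₂ L.Arc-resp fx≈v (Hom.arc f (compat u x∈X y∈Y)))

    δR-map : Hom (δR K) (δR L)
    δR-map = record
      { fun  = λ u → record
          { X = image (X u) ; Y = image (Y u) ; compat = image-compat u }
      ; cong = λ { {u} {v} ((X⊆ , X⊇) , (Y⊆ , Y⊇)) →
                   (image-mono {X u} {X v} X⊆ , image-mono {X v} {X u} X⊇)
                 , (image-mono {Y u} {Y v} Y⊆ , image-mono {Y v} {Y u} Y⊇) }
      ; arc  = λ { (z , z∈Y , z∈Z) →
                   fun z , resize (z , z∈Y , ≈.refl) , resize (z , z∈Z , ≈.refl) }
      }

  δR-RetractsTo : ∀ {c e a c′ e′ a′} {G : Digraph c e a} {H : Digraph c′ e′ a′}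
                → RetractsTo G H → RetractsTo (δR G) (δR H)
  δR-RetractsTo {G = G} {H = H} (emb , ret , ret∘emb≈id) =
    δR-map emb , δR-map ret , λ u → image-retract (X u) , image-retract (Y u)
    where
    module G = IsEquivalence (Digraph.isEquivalence G)
    module H = IsEquivalence (Digraph.isEquivalence H)

    image-retract : (S : Subset H _) → image ret (image emb S) ≐ˢ S
    image-retract S = shrink , expand
      where
      shrink : image ret (image emb S) ⊆ˢ S
      shrink v p =
        let (g , g∈embS , rg≈v) = unresize p
            (x , x∈S , ex≈g)    = unresize g∈embS
        in  resp S (H.trans (H.sym (ret∘emb≈id x)) (H.trans (Hom.cong ret ex≈g) rg≈v)) x∈S

      expand : S ⊆ˢ image ret (image emb S)
      expand v v∈S = resize (Hom.fun emb v , resize (v , v∈S , G.refl) , ret∘emb≈id v)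

  module _ {c ℓ₁ ℓ₂} (Q : Poset c ℓ₁ ℓ₂) where
    open Poset Q

    asSubset : Ideal Q → Subset (N Q) ℓ₂
    asSubset A = record
      { mem = elem A ; resp = λ x≈y x∈A → down A (reflexive (Eq.sym x≈y)) x∈A }

    complement : Ideal Q → Subset (N Q) ℓ₂
    complement A = record
      { mem = λ y → ¬ elem A y ; resp = λ x≈y x∉A y∈A → x∉A (down A (reflexive x≈y) y∈A) }

    downClosure : Subset (N Q) ℓ₂ → Ideal Q
    downClosure S = record
      { elem = λ z → Resize ℓ₂ (∃ λ x → mem S x × z ≤ x)
      ; down = λ y≤z p → let (x , x∈S , z≤x) = unresize p
                         in  resize (x , x∈S , trans y≤z z≤x)
      }

    downClosure-mono : {S T : Subset (N Q) ℓ₂}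
                     → S ⊆ˢ T → Poset._≤_ (I Q) (downClosure S) (downClosure T)
    downClosure-mono S⊆T z p =
      let (x , x∈S , z≤x) = unresize p in resize (x , S⊆T x x∈S , z≤x)

    ideal↦withComplement : Hom (N (I Q)) (δR (N Q))
    ideal↦withComplement = record
      { fun  = λ A → record
          { X = asSubset A ; Y = complement A
          ; compat = λ x∈A y∉A y≤x → y∉A (down A y≤x x∈A) }
      ; cong = λ { (A⊆B , B⊆A) →
                   (A⊆B , B⊆A)
                 , ((λ z z∉A z∈B → z∉A (B⊆A z z∈B)) , (λ z z∉B z∈A → z∉B (A⊆B z z∈A))) }
      ; arc  = λ B⊈A → let (z , z∈B , z∉A) = ¬⊆⇒∃∖ B⊈A in z , z∉A , z∈B
      }

    pair↦downClosure : Hom (δR (N Q)) (N (I Q))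
    pair↦downClosure = record
      { fun  = λ u → downClosure (X u)
      ; cong = λ { {u} {v} ((X⊆ , X⊇) , _) →
                   downClosure-mono {X u} {X v} X⊆ , downClosure-mono {X v} {X u} X⊇ }
      ; arc  = λ { {u} {v} (z , z∈Y , z∈Z) ↓Z⊆↓X →
                   let (x , x∈X , z≤x) = unresize (↓Z⊆↓X z (resize (z , z∈Z , refl)))
                   in  compat u x∈X z∈Y z≤x }
      }

    δR-N-RetractsTo-N-I : RetractsTo (δR (N Q)) (N (I Q))
    δR-N-RetractsTo-N-I =
      ideal↦withComplement , pair↦downClosure , λ A →
          (λ z p → let (x , x∈A , z≤x) = unresize p in down A z≤x x∈A)
        , (λ z z∈A → resize (z , z∈A , refl))

  δR^-N-RetractsTo-N-I^ : ∀ {c ℓ₁ ℓ₂} (P : Poset c ℓ₁ ℓ₂) (k : ℕ)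
                        → RetractsTo (δR^ k (N P)) (N (I^ k P))
  δR^-N-RetractsTo-N-I^ P zero    = RetractsTo-refl (N P)
  δR^-N-RetractsTo-N-I^ P (suc k) =
    RetractsTo-trans (δR-RetractsTo (δR^-N-RetractsTo-N-I^ P k)) (δR-N-RetractsTo-N-I (I^ k P))

corollary2p5 : (lem : ∀ {ℓ} → ExcludedMiddle ℓ)
    → {c ℓ₁ ℓ₂ : Level} (P : Poset c ℓ₁ ℓ₂) (k : ℕ)
    → RetractsTo (δR^ k (N P)) (N (I^ k P))
corollary2p5 lem = Classical.δR^-N-RetractsTo-N-I^ lem
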